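{- Let $\Phi = Q_1 x_1 \cdots Q_m x_m\, \psi$ be a prenex quantified Boolean formula with propositional matrix $\psi$ over the variables $x_1,\dots,x_m$, let $C$ be a clause and let $T$ be a cube, both over the variables $x_1,\dots,x_m$. Write $\Phi \land C$ for the QBF $Q_1 x_1 \cdots Q_m x_m\, (\psi \land C)$. If $\neg \Phi \models \neg T$ and $T \cap C \neq \emptyset$, then $\neg(\Phi \land C) \models \neg T$.
   Context: A clause is a disjunction of literals and a cube is a conjunction of literals, both identified with their (consistent) sets of literals; $T \cap C \neq \emptyset$ means that $T$ and $C$ share a literal. For a QBF $\Phi$ and a cube $T$, $\Phi|_T$ denotes the QBF obtained by setting every literal of $T$ to true (replacing each variable occurring in $T$ by the corresponding truth constant and removing it from the prefix). The cube-validity statement $\neg \Phi \models \neg T$ (as used for learned cubes in QCDCL solving) means that $\Phi|_T$ is a true QBF. -}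

module Defs where

open import Data.Nat using (ℕ)
open import Data.Bool using (Bool; true; false; _∧_; _∨_; not; if_then_else_)
open import Data.Fin using (Fin; _≟_)
open import Data.Fin.Base using () 
open import Data.List using (List; []; _∷_; foldr)
open import Data.Maybe using (Maybe; just; nothing)
open import Data.Product using (_×_; _,_; ∃-syntax)
open import Data.Vec.Functional using (Vector)
open import Relation.Nullary using (yes; no; ¬_)
open import Relation.Binary.PropositionalEquality using (_≡_)
open import Data.List.Membership.Propositional using (_∈_)

data Formula (m : ℕ) : Set where
  var  : Fin m → Formula m
  const : Bool → Formula m
  neg  : Formula m → Formula m
  _and_ : Formula m → Formula m → Formula m
  _or_  : Formula m → Formula m → Formula m

Assignment : ℕ → Set
Assignment m = Fin m → Bool

evalF : ∀ {m} → Assignment m → Formula m → Bool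
evalF σ (var x)   = σ x
evalF σ (const b) = b
evalF σ (neg φ)   = not (evalF σ φ)
evalF σ (φ and ψ) = evalF σ φ ∧ evalF σ ψ
evalF σ (φ or ψ)  = evalF σ φ ∨ evalF σ ψ

-- literals: a variable with a polarity (true = positive literal x, false = ¬x)
Literal : ℕ → Set
Literal m = Fin m × Bool

-- clauses and cubes are (finite) sets of literals, represented as lists
Clause : ℕ → Set
Clause m = List (Literal m)

Cube : ℕ → Set
Cube m = List (Literal m)

Consistent : ∀ {m} → List (Literal m) → Set
Consistent L = ∀ x → ¬ ((x , true) ∈ L × (x , false) ∈ L)

Intersects : ∀ {m} → List (Literal m) → List (Literal m) → Set
Intersects {m} T C = ∃[ l ] (l ∈ T × l ∈ C)

litFormula : ∀ {m} → Literal m → Formula m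
litFormula (x , true)  = var x
litFormula (x , false) = neg (var x)

clauseFormula : ∀ {m} → Clause m → Formula m
clauseFormula C = foldr (λ l φ → litFormula l or φ) (const false) C

data Quant : Set where
  ∀Q ∃Q : Quant

-- a prenex QBF  Q_1 x_1 ⋯ Q_m x_m ψ : the prefix is given by Q (variable i is
-- quantified by Q i, in the order 0,1,…,m-1) and ψ is the matrix
record QBF (m : ℕ) : Set where
  constructor qbf
  field
    prefix : Vector Quant m
    matrix : Formula m
open QBF public

_∧C_ : ∀ {m} → QBF m → Clause m → QBF m
Φ ∧C C = qbf (prefix Φ) (matrix Φ and clauseFormula C)

allVars : (n : ℕ) → List (Fin n)
allVars n = Data.List.allFin n

_[_≔_] : ∀ {m} → Assignment m → Fin m → Bool → Assignment m
(σ [ x ≔ b ]) y with x ≟ y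
... | yes _ = b
... | no  _ = σ y

evalPrefix : ∀ {m} → List (Quant × Fin m) → Assignment m → Formula m → Bool
evalPrefix [] σ ψ = evalF σ ψ
evalPrefix ((∀Q , x) ∷ qs) σ ψ = evalPrefix qs (σ [ x ≔ true ]) ψ ∧ evalPrefix qs (σ [ x ≔ false ]) ψ
evalPrefix ((∃Q , x) ∷ qs) σ ψ = evalPrefix qs (σ [ x ≔ true ]) ψ ∨ evalPrefix qs (σ [ x ≔ false ]) ψ

lookupCube : ∀ {m} → Cube m → Fin m → Maybe Bool
lookupCube [] x = nothing
lookupCube ((y , p) ∷ T) x with y ≟ x
... | yes _ = just p
... | no  _ = lookupCube T x

substF : ∀ {m} → Cube m → Formula m → Formula m
substF T (var x) with lookupCube T x
... | just b  = const b
... | nothing = var x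
substF T (const b) = const b
substF T (neg φ)   = neg (substF T φ)
substF T (φ and ψ) = substF T φ and substF T ψ
substF T (φ or ψ)  = substF T φ or substF T ψ

restrictPrefix : ∀ {m} → Cube m → Vector Quant m → List (Fin m) → List (Quant × Fin m)
restrictPrefix T Q [] = []
restrictPrefix T Q (x ∷ xs) with lookupCube T x
... | just _  = restrictPrefix T Q xs
... | nothing = (Q x , x) ∷ restrictPrefix T Q xs

-- truth of the QBF Φ|_T (all remaining variables are bound, so the
-- initial assignment is irrelevant; we start from the all-false one)
RestrictionTrue : ∀ {m} → QBF m → Cube m → Set
RestrictionTrue {m} Φ T =
  evalPrefix (restrictPrefix T (prefix Φ) (allVars m)) (λ _ → false) (substF T (matrix Φ)) ≡ true

-- ¬Φ ⊨ ¬T  (cube validity), defined as: Φ|_T is a true QBF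
_⊨cube_ : ∀ {m} → QBF m → Cube m → Set
Φ ⊨cube T = RestrictionTrue Φ T

{-# OPTIONS --safe #-}
-- Every literal of T is true in Φ|_T, so a clause meeting T becomes a tautology
-- after substituting T; conjoining a tautology to the matrix does not change the
-- value of the formula under any quantifier prefix.
module Submission where

open import Defs
open import Data.Nat using (ℕ)
open import Data.Bool using (Bool; true; false; _∧_; _∨_)
open import Data.Bool.Properties using (∧-identityʳ; ∨-zeroʳ)
open import Data.Fin using (Fin; _≟_)
open import Data.List using (List; []; _∷_)
open import Data.Maybe using (just)
open import Data.Maybe.Properties using (just-injective)
open import Data.Product using (_×_; _,_; ∃-syntax)
open import Data.Empty using (⊥-elim)
open import Data.List.Relation.Unary.Any using (here; there)
open import Data.List.Membership.Propositional using (_∈_)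
open import Relation.Nullary using (yes; no)
open import Relation.Binary.PropositionalEquality

private
  variable
    m : ℕ
    x : Fin m
    p q : Bool
    T : Cube m

Tautology : Formula m → Set
Tautology χ = ∀ σ → evalF σ χ ≡ true

Consistent-functional : Consistent T → (x , p) ∈ T → (x , q) ∈ T → p ≡ q
Consistent-functional {p = true}  {q = true}  _ _   _   = refl
Consistent-functional {p = false} {q = false} _ _   _   = refl
Consistent-functional {p = true}  {q = false} c x⁺ x⁻ = ⊥-elim (c _ (x⁺ , x⁻))
Consistent-functional {p = false} {q = true}  c x⁻ x⁺ = ⊥-elim (c _ (x⁺ , x⁻))

lookupCube-sound : ∀ (T : Cube m) → lookupCube T x ≡ just q → (x , q) ∈ T
lookupCube-sound {x = x} ((y , p) ∷ T) eq with y ≟ x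
... | yes refl = here (cong (x ,_) (sym (just-injective eq)))
... | no _     = there (lookupCube-sound T eq)

lookupCube-complete : ∀ (T : Cube m) → (x , p) ∈ T → ∃[ q ] lookupCube T x ≡ just q
lookupCube-complete {x = x} ((y , q) ∷ T) x∈T with y ≟ x
... | yes _ = q , refl
... | no y≢x with x∈T
...   | here refl  = ⊥-elim (y≢x refl)
...   | there x∈T′ = lookupCube-complete T x∈T′

lookupCube-∈ : Consistent T → (x , p) ∈ T → lookupCube T x ≡ just p
lookupCube-∈ {T = T} c x∈T with lookupCube-complete T x∈T
... | q , eq = trans eq (cong just (Consistent-functional c (lookupCube-sound T eq) x∈T))

substF-literal-tautology : ∀ {l} → Consistent T → l ∈ T → Tautology (substF T (litFormula l))
substF-literal-tautology {l = _ , true}  c l∈T _ rewrite lookupCube-∈ c l∈T = refl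
substF-literal-tautology {l = _ , false} c l∈T _ rewrite lookupCube-∈ c l∈T = refl

substF-clause-tautology : ∀ {l} (C : Clause m) → Consistent T → l ∈ T → l ∈ C →
                          Tautology (substF T (clauseFormula C))
substF-clause-tautology (_ ∷ C) c l∈T (here refl) σ
  rewrite substF-literal-tautology c l∈T σ = refl
substF-clause-tautology (_ ∷ C) c l∈T (there l∈C) σ
  rewrite substF-clause-tautology C c l∈T l∈C σ = ∨-zeroʳ _

evalPrefix-and-tautology : ∀ (qs : List (Quant × Fin m)) σ ψ {χ} → Tautology χ →
                           evalPrefix qs σ (ψ and χ) ≡ evalPrefix qs σ ψ
evalPrefix-and-tautology [] σ ψ taut rewrite taut σ = ∧-identityʳ _
evalPrefix-and-tautology ((∀Q , x) ∷ qs) σ ψ taut =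
  cong₂ _∧_ (evalPrefix-and-tautology qs (σ [ x ≔ true ]) ψ taut)
            (evalPrefix-and-tautology qs (σ [ x ≔ false ]) ψ taut)
evalPrefix-and-tautology ((∃Q , x) ∷ qs) σ ψ taut =
  cong₂ _∨_ (evalPrefix-and-tautology qs (σ [ x ≔ true ]) ψ taut)
            (evalPrefix-and-tautology qs (σ [ x ≔ false ]) ψ taut)

lemma1 : ∀ (m : ℕ) (Φ : QBF m) (C : Clause m) (T : Cube m) →
    Consistent C → Consistent T →
    Φ ⊨cube T → Intersects T C → (Φ ∧C C) ⊨cube T
lemma1 m Φ C T _ cT Φ|T (l , l∈T , l∈C) =
  trans (evalPrefix-and-tautology (restrictPrefix T (prefix Φ) (allVars m)) (λ _ → false)
           (substF T (matrix Φ)) (substF-clause-tautology C cT l∈T l∈C))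
        Φ|T
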